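{- Let $h\ge1$ and let $a:\mathbb Z\to\mathbb C$ satisfy $a(k)=a(\gcd(k,h))$ for all $k$ (with $\gcd(0,h)=h$, so $a(0)=a(h)$). Put $A(q)=\sum_{k=0}^{h-1}a(k)q^k$. Then $$\frac{A(q)}{1-q^h}-a(0)=\frac{\sum_{d\mid h}a(h/d)\Psi_d(q^{h/d})}{1-q^h}=\sum_{d\mid h}a(h/d)\sum_{d'\mid d}\mu(d')\frac{q^{hd'/d}}{1-q^{hd'/d}}$$ $$=a(0)\frac{q^h}{1-q^h}+\sum_{d\mid h,\ d>1}a(h/d)\sum_{d'\mid d}\frac{\mu(d')}{1-q^{hd'/d}},$$ and $$\frac{A(q)}{1-q^h}=\sum_{d\mid h}a(h/d)\sum_{d'\mid d}\frac{\mu(d')}{1-q^{hd'/d}}.$$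
   Context: $\mu$ is the Möbius function. For a positive integer $d$, $\Psi_d(q)=\sum q^{k}$, the sum over integers $k\in[1,d]$ with $\gcd(k,d)=1$ (so $\Psi_1(q)=q$). -}

module Defs where

open import Level using (Level)
open import Data.Bool using (Bool; true; false; if_then_else_)
open import Data.Nat as ℕ using (ℕ; zero; suc)
open import Data.Nat.Divisibility using (_∣?_)
open import Data.Nat.Primality using (prime?)
open import Data.Nat.GCD using (gcd)
open import Data.List using (List; []; _∷_; upTo; filter; length; foldr; map)
open import Data.Integer as ℤ using (ℤ; +_; -[1+_])
open import Relation.Nullary using (does; ¬?)
open import Algebra.Bundles using (CommutativeRing; Semiring)
import Algebra.Definitions.RawSemiring as RawSemiringDefs

primeDivisors : ℕ → List ℕ
primeDivisors n = filter (λ p → prime? p) (filter (λ p → p ∣? n) (upTo (suc n)))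

squarefree : ℕ → Bool
squarefree n = foldr (λ p b → if does ((p ℕ.* p) ∣? n) then false else b) true (primeDivisors n)

negOnePow : ℕ → ℤ
negOnePow zero = + 1
negOnePow (suc k) = ℤ.- negOnePow k

μ : ℕ → ℤ
μ n = if squarefree n then negOnePow (length (primeDivisors n)) else + 0

module _ {c ℓ : Level} (R : CommutativeRing c ℓ) where
  open CommutativeRing R
  open RawSemiringDefs (Semiring.rawSemiring semiring) using (_^_; _×_)

  ∑ : List Carrier → Carrier
  ∑ = foldr _+_ 0#

  ∑< : ℕ → (ℕ → Carrier) → Carrier
  ∑< n f = ∑ (map f (upTo n))

  -- ∑_{d ∣ n} f d (n/d)   (d ranges over the positive divisors of n,
  -- the second argument is the exact quotient n/d)
  ∑∣ : ℕ → (ℕ → ℕ → Carrier) → Carrier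
  ∑∣ n f = ∑< n (λ k → if does (suc k ∣? n) then f (suc k) (n ℕ./ suc k) else 0#)

  fromℤ : ℤ → Carrier
  fromℤ (+ n) = n × 1#
  fromℤ -[1+ n ] = - (suc n × 1#)

  Ψ : ℕ → Carrier → Carrier
  Ψ d x = ∑< d (λ j → if does (gcd (suc j) d ℕ.≟ 1) then x ^ suc j else 0#)

module Submission where

-- Every k ∈ [1, h] is uniquely k = e j with e = gcd(k, h), d = h/e and gcd(j, d) = 1, and a(k) = a(e).
-- Grouping the terms of A(q) by e therefore gives A(q) + a(0) qʰ = a(0) + Σ_{d∣h} a(h/d) Ψ_d(q^{h/d}).
-- Möbius inversion, [gcd(j, d) = 1] = Σ_{d′ ∣ gcd(j, d)} μ(d′), rewrites Ψ_d(x) as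
-- Σ_{d′∣d} μ(d′) Σ_{1 ≤ i ≤ d/d′} x^{d′i}, and summing these geometric progressions gives
-- Ψ_d(x)/(1 − x^d) = Σ_{d′∣d} μ(d′) x^{d′}/(1 − x^{d′}). The last two identities then follow from
-- x/(1 − x) = 1/(1 − x) − 1 and Σ_{d′∣d} μ(d′) = [d = 1].

open import Level using (Level)
open import Function using (id; _∘_; _⇔_; mk⇔; Equivalence)
open import Function.Properties.Equivalence using () renaming (trans to ⇔-trans; sym to ⇔-sym)
open import Data.Bool using (Bool; true; false; if_then_else_)
open import Data.Nat as ℕ using (ℕ; zero; suc; _≥_; _≤_; _<_; z≤n; s≤s; z<s; s<s)
open import Data.Nat.Properties as ℕ using (suc-injective; +-suc)
open import Data.Nat.Divisibility
open import Data.Nat.DivMod using (_/_; m*[n/m]≡n; m*n/n≡m; n/1≡n)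
open import Data.Nat.GCD
  using (gcd; gcd-greatest; gcd[m,n]∣m; gcd[m,n]∣n; gcd[m,n]≤n; gcd[m,n]≢0; c*gcd[m,n]≡gcd[cm,cn])
open import Data.Nat.Primality using (Prime; prime?; prime⇒irreducible; prime⇒nonZero; euclidsLemma; ¬prime[1])
open import Data.Nat.Primality.Factorisation using (PrimeFactorisation; factorise)
open import Data.Nat.Coprimality as Coprime using (Coprime; coprime-divisor)
open import Data.Integer as ℤ using (ℤ; +_; -[1+_]; ∣_∣)
open import Data.List using (List; []; _∷_; foldr; filter; length; applyUpTo; upTo)
open import Data.Nat.ListAction using (product)
open import Data.List.Membership.Propositional using (_∈_; find; lose)
open import Data.List.Membership.Propositional.Properties using (∈-filter⁺; ∈-filter⁻; ∈-upTo⁺)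
open import Data.List.Relation.Unary.All using (_∷_)
open import Data.List.Relation.Unary.Any using (Any; here; there)
open import Data.List.Properties using (map-upTo)
open import Data.Product using (_×_; _,_; proj₂; ∃-syntax)
open import Data.Sum using (_⊎_; inj₁; inj₂; [_,_]′)
open import Data.Empty using (⊥-elim)
open import Relation.Nullary using (does; Dec; yes; no; ¬_; contradiction; _×-dec_)
open import Relation.Nullary.Decidable using (does-⇔; dec-true; dec-false)
open import Relation.Binary.PropositionalEquality as ≡ using (_≡_; _≢_)
open import Algebra.Bundles using (CommutativeMonoid; CommutativeRing; Semiring)
import Algebra.Definitions.RawSemiring as RawSemiringDefs
import Relation.Binary.Reasoning.Setoid as ≈-Reasoning

open import Defs

m*k≡n⇒1≤m : ∀ {m k n} → 1 ≤ n → m ℕ.* k ≡ n → 1 ≤ m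
m*k≡n⇒1≤m {zero}  1≤n 0≡n = contradiction (≡.sym 0≡n) (ℕ.>⇒≢ 1≤n)
m*k≡n⇒1≤m {suc _} _   _   = s≤s z≤n

gcd[m*k,n*k]≡gcd[m,n]*k : ∀ m n k → gcd (m ℕ.* k) (n ℕ.* k) ≡ gcd m n ℕ.* k
gcd[m*k,n*k]≡gcd[m,n]*k m n k = begin
  gcd (m ℕ.* k) (n ℕ.* k) ≡⟨ ≡.cong₂ gcd (ℕ.*-comm m k) (ℕ.*-comm n k) ⟩
  gcd (k ℕ.* m) (k ℕ.* n) ≡⟨ ≡.sym (c*gcd[m,n]≡gcd[cm,cn] k m n) ⟩
  k ℕ.* gcd m n           ≡⟨ ℕ.*-comm k (gcd m n) ⟩
  gcd m n ℕ.* k           ∎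
  where open ≡.≡-Reasoning

coprime⇒gcd[m*k,n*k]≡k : ∀ {m n k} → gcd m n ≡ 1 → gcd (m ℕ.* k) (n ℕ.* k) ≡ k
coprime⇒gcd[m*k,n*k]≡k {m} {n} {k} coprime =
  ≡.trans (gcd[m*k,n*k]≡gcd[m,n]*k m n k) (≡.trans (≡.cong (ℕ._* k) coprime) (ℕ.*-identityˡ k))

gcd[m*k,n*k]≡k⇒coprime : ∀ {m n k} .{{_ : ℕ.NonZero k}} → gcd (m ℕ.* k) (n ℕ.* k) ≡ k → gcd m n ≡ 1
gcd[m*k,n*k]≡k⇒coprime {m} {n} {k} gcd≡k =
  ℕ.*-cancelʳ-≡ (gcd m n) 1 k
    (≡.trans (≡.sym (gcd[m*k,n*k]≡gcd[m,n]*k m n k)) (≡.trans gcd≡k (≡.sym (ℕ.*-identityˡ k))))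

module FiniteSum {c ℓ : Level} (M : CommutativeMonoid c ℓ) where
  open CommutativeMonoid M
  open import Algebra.Properties.CommutativeSemigroup commutativeSemigroup using (interchange)
  open ≈-Reasoning setoid

  -- Folding over applyUpTo makes sumUpTo (suc n) f reduce to f 0 ∙ sumUpTo n (f ∘ suc);
  -- the sums ∑< of Defs are related to it by ∑<≡sumUpTo.
  sumUpTo : ℕ → (ℕ → Carrier) → Carrier
  sumUpTo n f = foldr _∙_ ε (applyUpTo f n)

  sumUpTo-cong : ∀ n {f g} → (∀ k → k < n → f k ≈ g k) → sumUpTo n f ≈ sumUpTo n g
  sumUpTo-cong zero    f≈g = refl
  sumUpTo-cong (suc n) f≈g = ∙-cong (f≈g 0 z<s) (sumUpTo-cong n (λ k k<n → f≈g (suc k) (s<s k<n)))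

  sumUpTo-zero : ∀ n {f} → (∀ k → k < n → f k ≈ ε) → sumUpTo n f ≈ ε
  sumUpTo-zero zero    f≈ε = refl
  sumUpTo-zero (suc n) f≈ε =
    trans (∙-cong (f≈ε 0 z<s) (sumUpTo-zero n (λ k k<n → f≈ε (suc k) (s<s k<n)))) (identityˡ ε)

  sumUpTo-∙ : ∀ n (f g : ℕ → Carrier) → sumUpTo n (λ k → f k ∙ g k) ≈ sumUpTo n f ∙ sumUpTo n g
  sumUpTo-∙ zero    f g = sym (identityˡ ε)
  sumUpTo-∙ (suc n) f g = trans (∙-congˡ (sumUpTo-∙ n (f ∘ suc) (g ∘ suc))) (interchange _ _ _ _)

  sumUpTo-+ : ∀ m n (f : ℕ → Carrier) →
              sumUpTo (m ℕ.+ n) f ≈ sumUpTo m f ∙ sumUpTo n (λ k → f (m ℕ.+ k))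
  sumUpTo-+ zero    n f = sym (identityˡ _)
  sumUpTo-+ (suc m) n f = trans (∙-congˡ (sumUpTo-+ m n (f ∘ suc))) (sym (assoc _ _ _))

  sumUpTo-suc : ∀ n f → sumUpTo (suc n) f ≈ sumUpTo n f ∙ f n
  sumUpTo-suc zero    f = trans (identityʳ (f 0)) (sym (identityˡ (f 0)))
  sumUpTo-suc (suc n) f = trans (∙-congˡ (sumUpTo-suc n (f ∘ suc))) (sym (assoc _ _ _))

  sumUpTo-extend : ∀ m n {f} → m ≤ n → (∀ k → m ≤ k → k < n → f k ≈ ε) → sumUpTo n f ≈ sumUpTo m f
  sumUpTo-extend zero    n       _         f≈ε = sumUpTo-zero n (λ k → f≈ε k z≤n)
  sumUpTo-extend (suc m) (suc n) (s≤s m≤n) f≈ε =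
    ∙-congˡ (sumUpTo-extend m n m≤n (λ k m≤k k<n → f≈ε (suc k) (s≤s m≤k) (s<s k<n)))

  sumUpTo-single : ∀ n m {f} → m < n → (∀ k → k < n → k ≢ m → f k ≈ ε) → sumUpTo n f ≈ f m
  sumUpTo-single (suc n) zero    _         f≈ε =
    trans (∙-congˡ (sumUpTo-zero n (λ k k<n → f≈ε (suc k) (s<s k<n) (λ ())))) (identityʳ _)
  sumUpTo-single (suc n) (suc m) (s<s m<n) f≈ε =
    trans (∙-congʳ (f≈ε 0 z<s (λ ())))
          (trans (identityˡ _) (sumUpTo-single n m m<n
            (λ k k<n k≢m → f≈ε (suc k) (s<s k<n) (k≢m ∘ suc-injective))))

  sumUpTo-comm : ∀ m n (f : ℕ → ℕ → Carrier) →
                 sumUpTo m (λ i → sumUpTo n (f i)) ≈ sumUpTo n (λ j → sumUpTo m (λ i → f i j))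
  sumUpTo-comm zero    n f = sym (sumUpTo-zero n (λ _ _ → refl))
  sumUpTo-comm (suc m) n f = trans (∙-congˡ (sumUpTo-comm m n (f ∘ suc))) (sym (sumUpTo-∙ n (f 0) _))

  sumUpTo-multiples : ∀ d m (f : ℕ → Carrier) →
    sumUpTo (m ℕ.* suc d) (λ k → if does (suc d ∣? suc k) then f (suc k) else ε)
      ≈ sumUpTo m (λ j → f (suc j ℕ.* suc d))
  sumUpTo-multiples d zero    f = refl
  sumUpTo-multiples d (suc m) f = begin
    sumUpTo (D ℕ.+ m ℕ.* D) g
      ≈⟨ sumUpTo-+ D (m ℕ.* D) g ⟩
    sumUpTo D g ∙ sumUpTo (m ℕ.* D) (λ k → g (D ℕ.+ k))
      ≈⟨ ∙-cong firstBlock (sumUpTo-cong (m ℕ.* D) (λ k _ → shift k)) ⟩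
    f (1 ℕ.* D) ∙ sumUpTo (m ℕ.* D) (λ k → if does (D ∣? suc k) then f (D ℕ.+ suc k) else ε)
      ≈⟨ ∙-congˡ (sumUpTo-multiples d m (λ x → f (D ℕ.+ x))) ⟩
    sumUpTo (suc m) (λ j → f (suc j ℕ.* D)) ∎
    where
    D : ℕ
    D = suc d
    g : ℕ → Carrier
    g k = if does (D ∣? suc k) then f (suc k) else ε
    firstBlock : sumUpTo D g ≈ f (1 ℕ.* D)
    firstBlock = trans (sumUpTo-single D d (ℕ.n<1+n d) others) (reflexive atD)
      where
      others : ∀ k → k < D → k ≢ d → g k ≈ ε
      others k k<D k≢d
        rewrite dec-false (D ∣? suc k) (>⇒∤ (s<s (ℕ.≤∧≢⇒< (ℕ.s≤s⁻¹ k<D) k≢d))) = refl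
      atD : g d ≡ f (1 ℕ.* D)
      atD rewrite dec-true (D ∣? D) ∣-refl | ℕ.*-identityˡ D = ≡.refl
    shift : ∀ k → g (D ℕ.+ k) ≈ (if does (D ∣? suc k) then f (D ℕ.+ suc k) else ε)
    shift k = reflexive (≡.cong₂ (λ b x → if b then f x else ε)
      (does-⇔ (mk⇔ (λ D∣ → ∣m+n∣m⇒∣n (≡.subst (D ∣_) (≡.sym (+-suc D k)) D∣) ∣-refl)
                   (λ D∣ → ≡.subst (D ∣_) (+-suc D k) (∣m∣n⇒∣m+n ∣-refl D∣)))
              (D ∣? suc (D ℕ.+ k)) (D ∣? suc k))
      (≡.sym (+-suc D k)))

module MobiusFunction where
  open FiniteSum ℕ.+-0-commutativeMonoid using (sumUpTo; sumUpTo-cong; sumUpTo-∙; sumUpTo-single; sumUpTo-extend)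

  prime∣prime⇒≡ : ∀ {p r} → Prime p → Prime r → p ∣ r → p ≡ r
  prime∣prime⇒≡ pp pr p∣r with prime⇒irreducible pr p∣r
  ... | inj₁ ≡.refl = contradiction pp ¬prime[1]
  ... | inj₂ p≡r    = p≡r

  prime∤⇒coprime : ∀ {p x} → Prime p → ¬ p ∣ x → Coprime p x
  prime∤⇒coprime pp p∤x (i∣p , i∣x) with prime⇒irreducible pp i∣p
  ... | inj₁ i≡1     = i≡1
  ... | inj₂ ≡.refl = contradiction i∣x p∤x

  prime-divisor : ∀ n → 2 ≤ n → ∃[ p ] (Prime p × p ∣ n)
  prime-divisor n@(suc _) 2≤n
    with PrimeFactorisation.factors (factorise n) | PrimeFactorisation.isFactorisation (factorise n)
       | PrimeFactorisation.factorsPrime (factorise n)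
  ... | []     | n≡1   | _        = contradiction n≡1 (ℕ.>⇒≢ 2≤n)
  ... | p ∷ ps | n≡p*ps | pp ∷ _ = p , pp , divides (product ps) (≡.trans n≡p*ps (ℕ.*-comm p _))

  ∈-primeDivisors⁺ : ∀ {p n} → 1 ≤ n → p ∣ n → Prime p → p ∈ primeDivisors n
  ∈-primeDivisors⁺ {p} {n} 1≤n p∣n pp =
    ∈-filter⁺ prime? (∈-filter⁺ (_∣? n) (∈-upTo⁺ (s≤s (∣⇒≤ {{ℕ.>-nonZero 1≤n}} p∣n))) p∣n) pp

  ∈-primeDivisors⁻ : ∀ {p n} → p ∈ primeDivisors n → p ∣ n × Prime p
  ∈-primeDivisors⁻ {p} {n} p∈ with p∈′ , pp ← ∈-filter⁻ prime? p∈
                             with _ , p∣n ← ∈-filter⁻ (_∣? n) {xs = upTo (suc n)} p∈′ = p∣n , pp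

  squareFreeOn : ℕ → List ℕ → Bool
  squareFreeOn n = foldr (λ p b → if does ((p ℕ.* p) ∣? n) then false else b) true

  squareFreeOn≡false⇔Any : ∀ n xs → squareFreeOn n xs ≡ false ⇔ Any (λ p → p ℕ.* p ∣ n) xs
  squareFreeOn≡false⇔Any n []       = mk⇔ (λ ()) (λ ())
  squareFreeOn≡false⇔Any n (x ∷ xs) with (x ℕ.* x) ∣? n
  ... | yes x²∣n = mk⇔ (λ _ → here x²∣n) (λ _ → ≡.refl)
  ... | no  x²∤n = mk⇔ (there ∘ Equivalence.to ih) from
    where
    ih : squareFreeOn n xs ≡ false ⇔ Any (λ p → p ℕ.* p ∣ n) xs
    ih = squareFreeOn≡false⇔Any n xs
    from : Any (λ p → p ℕ.* p ∣ n) (x ∷ xs) → squareFreeOn n xs ≡ false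
    from (here x²∣n) = contradiction x²∣n x²∤n
    from (there any) = Equivalence.from ih any

  squarefree≡false⇔ : ∀ {n} → 1 ≤ n → squarefree n ≡ false ⇔ (∃[ p ] (Prime p × p ℕ.* p ∣ n))
  squarefree≡false⇔ {n} 1≤n = mk⇔ to from
    where
    anySquare : squarefree n ≡ false ⇔ Any (λ p → p ℕ.* p ∣ n) (primeDivisors n)
    anySquare = squareFreeOn≡false⇔Any n (primeDivisors n)
    to : squarefree n ≡ false → ∃[ p ] (Prime p × p ℕ.* p ∣ n)
    to sf≡false with p , p∈ , p²∣n ← find (Equivalence.to anySquare sf≡false) =
      p , proj₂ (∈-primeDivisors⁻ {n = n} p∈) , p²∣n
    from : ∃[ p ] (Prime p × p ℕ.* p ∣ n) → squarefree n ≡ false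
    from (p , pp , p²∣n) =
      Equivalence.from anySquare (lose (∈-primeDivisors⁺ 1≤n (m*n∣⇒m∣ p p p²∣n) pp) p²∣n)

  squarefree-*-prime : ∀ {p d} → Prime p → ¬ p ∣ d → 1 ≤ d → squarefree (d ℕ.* p) ≡ squarefree d
  squarefree-*-prime {p} {d} pp p∤d 1≤d =
    ≡false⇔⇒≡ (squarefree (d ℕ.* p)) (squarefree d)
      (⇔-trans (squarefree≡false⇔ (ℕ.*-mono-≤ 1≤d (ℕ.>-nonZero⁻¹ p {{prime⇒nonZero pp}})))
      (⇔-trans (mk⇔ to from) (⇔-sym (squarefree≡false⇔ 1≤d))))
    where
    ≡false⇔⇒≡ : ∀ b b′ → b ≡ false ⇔ b′ ≡ false → b ≡ b′
    ≡false⇔⇒≡ false b′     b⇔b′ = ≡.sym (Equivalence.to b⇔b′ ≡.refl)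
    ≡false⇔⇒≡ true  false  b⇔b′ = Equivalence.from b⇔b′ ≡.refl
    ≡false⇔⇒≡ true  true   _    = ≡.refl
    to : ∃[ r ] (Prime r × r ℕ.* r ∣ d ℕ.* p) → ∃[ r ] (Prime r × r ℕ.* r ∣ d)
    to (r , pr , r²∣dp) with r ℕ.≟ p
    ... | yes ≡.refl = contradiction (*-cancelʳ-∣ p {{prime⇒nonZero pp}} r²∣dp) p∤d
    ... | no  r≢p    = r , pr , coprime-divisor (Coprime.sym (prime∤⇒coprime pp p∤r²))
                                  (≡.subst (r ℕ.* r ∣_) (ℕ.*-comm d p) r²∣dp)
      where
      p∤r² : ¬ p ∣ r ℕ.* r
      p∤r² p∣r² with euclidsLemma r r pp p∣r²
      ... | inj₁ p∣r = r≢p (≡.sym (prime∣prime⇒≡ pp pr p∣r))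
      ... | inj₂ p∣r = r≢p (≡.sym (prime∣prime⇒≡ pp pr p∣r))
    from : ∃[ r ] (Prime r × r ℕ.* r ∣ d) → ∃[ r ] (Prime r × r ℕ.* r ∣ d ℕ.* p)
    from (r , pr , r²∣d) = r , pr , ∣m⇒∣m*n p r²∣d

  indicator : ∀ {a} {A : Set a} → Dec A → ℕ
  indicator A? = if does A? then 1 else 0

  indicator-⊎ : ∀ {a b c} {A : Set a} {B : Set b} {C : Set c} → A ⇔ (B ⊎ C) → (B → ¬ C) →
                (A? : Dec A) (B? : Dec B) (C? : Dec C) → indicator A? ≡ indicator B? ℕ.+ indicator C?
  indicator-⊎ _      B→¬C (yes _) (yes b) (yes c) = contradiction c (B→¬C b)
  indicator-⊎ _      _    (yes _) (yes _) (no _)  = ≡.refl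
  indicator-⊎ _      _    (yes _) (no _)  (yes _) = ≡.refl
  indicator-⊎ A⇔B⊎C _    (yes a) (no ¬b) (no ¬c) = ⊥-elim ([ ¬b , ¬c ]′ (Equivalence.to A⇔B⊎C a))
  indicator-⊎ A⇔B⊎C _    (no ¬a) (yes b) _       = contradiction (Equivalence.from A⇔B⊎C (inj₁ b)) ¬a
  indicator-⊎ A⇔B⊎C _    (no ¬a) (no _)  (yes c) = contradiction (Equivalence.from A⇔B⊎C (inj₂ c)) ¬a
  indicator-⊎ _      _    (no _)  (no _)  (no _)  = ≡.refl

  length-primeDivisors : ∀ n →
    length (primeDivisors n) ≡ sumUpTo (suc n) (λ r → indicator (r ∣? n ×-dec prime? r))
  length-primeDivisors n = count id (suc n)
    where
    count : ∀ g N → length (filter prime? (filter (_∣? n) (applyUpTo g N)))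
                    ≡ sumUpTo N (λ r → indicator (g r ∣? n ×-dec prime? (g r)))
    count g zero = ≡.refl
    count g (suc N) with g 0 ∣? n
    ... | no _  = count (g ∘ suc) N
    ... | yes _ with prime? (g 0)
    ...   | yes _ = ≡.cong suc (count (g ∘ suc) N)
    ...   | no _  = count (g ∘ suc) N

  primeDivisor-*-prime⇔ : ∀ {p d r} → Prime p → (r ∣ d ℕ.* p × Prime r) ⇔ (r ≡ p ⊎ (r ∣ d × Prime r))
  primeDivisor-*-prime⇔ {p} {d} {r} pp = mk⇔ to from
    where
    to : r ∣ d ℕ.* p × Prime r → r ≡ p ⊎ (r ∣ d × Prime r)
    to (r∣dp , pr) with euclidsLemma d p pr r∣dp
    ... | inj₁ r∣d = inj₂ (r∣d , pr)
    ... | inj₂ r∣p = inj₁ (prime∣prime⇒≡ pr pp r∣p)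
    from : r ≡ p ⊎ (r ∣ d × Prime r) → r ∣ d ℕ.* p × Prime r
    from (inj₁ ≡.refl)     = n∣m*n d , pp
    from (inj₂ (r∣d , pr)) = ∣m⇒∣m*n p r∣d , pr

  length-primeDivisors-*-prime : ∀ {p d} → Prime p → ¬ p ∣ d → 1 ≤ d →
                                 length (primeDivisors (d ℕ.* p)) ≡ suc (length (primeDivisors d))
  length-primeDivisors-*-prime {p} {d} pp p∤d 1≤d = begin
    length (primeDivisors n)                              ≡⟨ length-primeDivisors n ⟩
    sumUpTo (suc n) (λ r → indicator (r ∣? n ×-dec prime? r))
      ≡⟨ sumUpTo-cong (suc n) (λ r _ → indicator-⊎ (primeDivisor-*-prime⇔ pp) disjoint
                                          (r ∣? n ×-dec prime? r) (r ℕ.≟ p) (r ∣? d ×-dec prime? r)) ⟩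
    sumUpTo (suc n) (λ r → indicator (r ℕ.≟ p) ℕ.+ indicator (r ∣? d ×-dec prime? r))
      ≡⟨ sumUpTo-∙ (suc n) (λ r → indicator (r ℕ.≟ p)) (λ r → indicator (r ∣? d ×-dec prime? r)) ⟩
    sumUpTo (suc n) (λ r → indicator (r ℕ.≟ p))
      ℕ.+ sumUpTo (suc n) (λ r → indicator (r ∣? d ×-dec prime? r))
      ≡⟨ ≡.cong₂ ℕ._+_ onlyP beyondD ⟩
    suc (sumUpTo (suc d) (λ r → indicator (r ∣? d ×-dec prime? r)))
      ≡⟨ ≡.cong suc (≡.sym (length-primeDivisors d)) ⟩
    suc (length (primeDivisors d)) ∎
    where
    open ≡.≡-Reasoning
    n : ℕ
    n = d ℕ.* p
    disjoint : ∀ {r} → r ≡ p → ¬ (r ∣ d × Prime r)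
    disjoint ≡.refl (p∣d , _) = p∤d p∣d
    onlyP : sumUpTo (suc n) (λ r → indicator (r ℕ.≟ p)) ≡ 1
    onlyP = ≡.trans (sumUpTo-single (suc n) p (s≤s (ℕ.m≤n*m p d {{ℕ.>-nonZero 1≤d}})) others)
                    (≡.cong (λ b → if b then 1 else 0) (dec-true (p ℕ.≟ p) ≡.refl))
      where
      others : ∀ r → r < suc n → r ≢ p → indicator (r ℕ.≟ p) ≡ 0
      others r _ r≢p rewrite dec-false (r ℕ.≟ p) r≢p = ≡.refl
    beyondD : sumUpTo (suc n) (λ r → indicator (r ∣? d ×-dec prime? r))
              ≡ sumUpTo (suc d) (λ r → indicator (r ∣? d ×-dec prime? r))
    beyondD = sumUpTo-extend (suc d) (suc n) (s≤s (ℕ.m≤m*n d p {{prime⇒nonZero pp}})) zeros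
      where
      zeros : ∀ r → suc d ≤ r → r < suc n → indicator (r ∣? d ×-dec prime? r) ≡ 0
      zeros r d<r _ rewrite dec-false (r ∣? d) (>⇒∤ {{ℕ.>-nonZero 1≤d}} d<r) = ≡.refl

  μ-*-prime : ∀ {p d} → Prime p → ¬ p ∣ d → 1 ≤ d → μ (d ℕ.* p) ≡ ℤ.- μ d
  μ-*-prime {p} {d} pp p∤d 1≤d
    rewrite squarefree-*-prime pp p∤d 1≤d | length-primeDivisors-*-prime pp p∤d 1≤d with squarefree d
  ... | true  = ≡.refl
  ... | false = ≡.refl

  μ-square : ∀ {p n} → Prime p → p ℕ.* p ∣ n → 1 ≤ n → μ n ≡ + 0
  μ-square {p} {n} pp p²∣n 1≤n
    rewrite Equivalence.from (squarefree≡false⇔ 1≤n) (p , pp , p²∣n) = ≡.refl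

module RingSums {c ℓ : Level} (R : CommutativeRing c ℓ) where
  open CommutativeRing R
  open RawSemiringDefs (Semiring.rawSemiring semiring) using (_^_)
  open import Algebra.Properties.Ring ring
    using (-‿distribˡ-*; -‿+-comm; -‿involutive; -0#≈0#; x[y-z]≈xy-xz; +-cancelʳ)
  open import Algebra.Properties.CommutativeSemigroup *-commutativeSemigroup using (x∙yz≈y∙xz)
  open FiniteSum +-commutativeMonoid public
  open ≈-Reasoning setoid

  ∑<≡sumUpTo : ∀ n f → ∑< R n f ≡ sumUpTo n f
  ∑<≡sumUpTo n f = ≡.cong (foldr _+_ 0#) (map-upTo f n)

  sumUpTo-*ˡ : ∀ n x f → x * sumUpTo n f ≈ sumUpTo n (λ k → x * f k)
  sumUpTo-*ˡ zero    x f = zeroʳ x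
  sumUpTo-*ˡ (suc n) x f = trans (distribˡ x _ _) (+-congˡ (sumUpTo-*ˡ n x (f ∘ suc)))

  sumUpTo-*ʳ : ∀ n x f → sumUpTo n f * x ≈ sumUpTo n (λ k → f k * x)
  sumUpTo-*ʳ n x f = trans (*-comm _ x) (trans (sumUpTo-*ˡ n x f) (sumUpTo-cong n (λ k _ → *-comm x (f k))))

  sumUpTo-neg : ∀ n f → sumUpTo n (λ k → - f k) ≈ - sumUpTo n f
  sumUpTo-neg zero    f = sym -0#≈0#
  sumUpTo-neg (suc n) f = trans (+-congˡ (sumUpTo-neg n (f ∘ suc))) (-‿+-comm _ _)

  [1-y]z≈z-yz : ∀ y z → (1# - y) * z ≈ z - y * z
  [1-y]z≈z-yz y z = trans (distribʳ z 1# (- y)) (+-cong (*-identityˡ z) (sym (-‿distribˡ-* y z)))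

  x-y+[y-z]≈x-z : ∀ x y z → (x - y) + (y - z) ≈ x - z
  x-y+[y-z]≈x-z x y z = begin
    (x - y) + (y - z)   ≈⟨ +-assoc x (- y) (y - z) ⟩
    x + (- y + (y - z)) ≈⟨ +-congˡ (sym (+-assoc (- y) y (- z))) ⟩
    x + ((- y + y) - z) ≈⟨ +-congˡ (+-congʳ (-‿inverseˡ y)) ⟩
    x + (0# - z)        ≈⟨ +-congˡ (+-identityˡ (- z)) ⟩
    x - z               ∎

  geometric-sum : ∀ m y → (1# - y) * sumUpTo m (y ^_) ≈ 1# - y ^ m
  geometric-sum zero    y = trans (zeroʳ _) (sym (-‿inverseʳ 1#))
  geometric-sum (suc m) y = begin
    (1# - y) * (1# + sumUpTo m (λ i → y * y ^ i))  ≈⟨ *-congˡ (+-congˡ (sym (sumUpTo-*ˡ m y (y ^_)))) ⟩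
    (1# - y) * (1# + y * S)                        ≈⟨ distribˡ _ _ _ ⟩
    (1# - y) * 1# + (1# - y) * (y * S)             ≈⟨ +-cong (*-identityʳ _) (x∙yz≈y∙xz _ _ _) ⟩
    (1# - y) + y * ((1# - y) * S)                  ≈⟨ +-congˡ (*-congˡ (geometric-sum m y)) ⟩
    (1# - y) + y * (1# - y ^ m)                    ≈⟨ +-congˡ (x[y-z]≈xy-xz y 1# (y ^ m)) ⟩
    (1# - y) + (y * 1# - y ^ suc m)                ≈⟨ +-congˡ (+-congʳ (*-identityʳ y)) ⟩
    (1# - y) + (y - y ^ suc m)                     ≈⟨ x-y+[y-z]≈x-z 1# y (y ^ suc m) ⟩
    1# - y ^ suc m                                 ∎
    where
    S : Carrier
    S = sumUpTo m (y ^_)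

  x-[x-y]≈y : ∀ x y → x - (x - y) ≈ y
  x-[x-y]≈y x y = begin
    x - (x - y)      ≈⟨ +-congˡ (sym (-‿+-comm x (- y))) ⟩
    x + (- x - - y)  ≈⟨ +-congˡ (+-congˡ (-‿involutive y)) ⟩
    x + (- x + y)    ≈⟨ sym (+-assoc x (- x) y) ⟩
    (x - x) + y      ≈⟨ +-congʳ (-‿inverseʳ x) ⟩
    0# + y           ≈⟨ +-identityˡ y ⟩
    y                ∎

  x+[b-a]≈b+t⇒x-a≈t : ∀ x a b t → x + (b - a) ≈ b + t → x - a ≈ t
  x+[b-a]≈b+t⇒x-a≈t x a b t eq = +-cancelʳ b (x - a) t (begin
    (x - a) + b    ≈⟨ +-assoc x (- a) b ⟩
    x + (- a + b)  ≈⟨ +-congˡ (+-comm (- a) b) ⟩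
    x + (b - a)    ≈⟨ eq ⟩
    b + t          ≈⟨ +-comm b t ⟩
    t + b          ∎)

  [b+v]-a≈[b-a]+v : ∀ a b v → (b + v) - a ≈ (b - a) + v
  [b+v]-a≈[b-a]+v a b v = begin
    (b + v) - a    ≈⟨ +-assoc b v (- a) ⟩
    b + (v - a)    ≈⟨ +-congˡ (+-comm v (- a)) ⟩
    b + (- a + v)  ≈⟨ sym (+-assoc b (- a) v) ⟩
    (b - a) + v    ∎

  [1-y]z≈1⇒yz≈z-1 : ∀ y z → (1# - y) * z ≈ 1# → y * z ≈ z - 1#
  [1-y]z≈1⇒yz≈z-1 y z [1-y]z≈1 = begin
    y * z              ≈⟨ sym (x-[x-y]≈y z (y * z)) ⟩
    z - (z - y * z)    ≈⟨ +-congˡ (-‿cong (trans (sym ([1-y]z≈z-yz y z)) [1-y]z≈1)) ⟩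
    z - 1#             ∎

  yz≈z-1⇒x[yz]≈xz-x : ∀ x {y z} → y * z ≈ z - 1# → x * (y * z) ≈ x * z - x
  yz≈z-1⇒x[yz]≈xz-x x {y} {z} yz≈z-1 =
    trans (*-congˡ yz≈z-1) (trans (x[y-z]≈xy-xz x z 1#) (+-congˡ (-‿cong (*-identityʳ x))))

  geometric-sum-inverse : ∀ m y z w → (1# - y) * z ≈ 1# → (1# - y ^ m) * w ≈ 1# →
                          sumUpTo m (y ^_) * w ≈ z
  geometric-sum-inverse m y z w [1-y]z≈1 [1-yᵐ]w≈1 = begin
    S * w                     ≈⟨ sym (*-identityˡ _) ⟩
    1# * (S * w)              ≈⟨ *-congʳ (trans (sym [1-y]z≈1) (*-comm _ z)) ⟩
    (z * (1# - y)) * (S * w)  ≈⟨ *-assoc z _ _ ⟩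
    z * ((1# - y) * (S * w))  ≈⟨ *-congˡ (sym (*-assoc _ S w)) ⟩
    z * ((1# - y) * S * w)    ≈⟨ *-congˡ (*-congʳ (geometric-sum m y)) ⟩
    z * ((1# - y ^ m) * w)    ≈⟨ *-congˡ [1-yᵐ]w≈1 ⟩
    z * 1#                    ≈⟨ *-identityʳ z ⟩
    z                         ∎
    where
    S : Carrier
    S = sumUpTo m (y ^_)

  if-+ : ∀ b x y → (if b then x + y else 0#) ≈ (if b then x else 0#) + (if b then y else 0#)
  if-+ true  x y = refl
  if-+ false x y = sym (+-identityˡ 0#)

  if-neg : ∀ b x → (if b then - x else 0#) ≈ - (if b then x else 0#)
  if-neg true  x = refl
  if-neg false x = sym -0#≈0#

  if-*ˡ : ∀ b x y → x * (if b then y else 0#) ≈ (if b then x * y else 0#)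
  if-*ˡ true  x y = refl
  if-*ˡ false x y = zeroʳ x

  if-*ʳ : ∀ b x y → (if b then x else 0#) * y ≈ (if b then x * y else 0#)
  if-*ʳ true  x y = refl
  if-*ʳ false x y = zeroˡ y

  if-if : ∀ b b′ x →
          (if b then (if b′ then x else 0#) else 0#) ≡ (if b′ then (if b then x else 0#) else 0#)
  if-if true  b′    x = ≡.refl
  if-if false true  x = ≡.refl
  if-if false false x = ≡.refl

  if-0# : ∀ b → (if b then 0# else 0#) ≡ 0#
  if-0# true  = ≡.refl
  if-0# false = ≡.refl

  if≈if1#* : ∀ b x → (if b then x else 0#) ≈ (if b then 1# else 0#) * x
  if≈if1#* true  x = sym (*-identityˡ x)
  if≈if1#* false x = sym (zeroˡ x)

  if-split : ∀ b x → x ≈ (if b then x else 0#) + (if b then 0# else x)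
  if-split true  x = sym (+-identityʳ x)
  if-split false x = sym (+-identityˡ x)

  sumUpTo-if : ∀ n b f → sumUpTo n (λ k → if b then f k else 0#) ≈ (if b then sumUpTo n f else 0#)
  sumUpTo-if n true  f = refl
  sumUpTo-if n false f = sumUpTo-zero n (λ _ _ → refl)

  ∑∣≈sumUpTo : ∀ n f →
    ∑∣ R n f ≈ sumUpTo n (λ k → if does (suc k ∣? n) then f (suc k) (n / suc k) else 0#)
  ∑∣≈sumUpTo n f = reflexive (∑<≡sumUpTo n _)

  -- The quotient e = n / d is characterised by d * e ≡ n, which keeps division out of all callers.
  ∑∣-cong : ∀ n {f g} → (∀ d e → d ℕ.* e ≡ n → f d e ≈ g d e) → ∑∣ R n f ≈ ∑∣ R n g
  ∑∣-cong n {f} {g} f≈g = begin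
    ∑∣ R n f   ≈⟨ ∑∣≈sumUpTo n f ⟩
    sumUpTo n _ ≈⟨ sumUpTo-cong n (λ k _ → term k (suc k ∣? n)) ⟩
    sumUpTo n _ ≈⟨ sym (∑∣≈sumUpTo n g) ⟩
    ∑∣ R n g   ∎
    where
    term : ∀ k (k∣n? : Dec (suc k ∣ n)) →
           (if does k∣n? then f (suc k) (n / suc k) else 0#) ≈ (if does k∣n? then g (suc k) (n / suc k) else 0#)
    term k (yes k∣n) = f≈g (suc k) (n / suc k) (m*[n/m]≡n k∣n)
    term k (no _)    = refl

  ∑∣-one : ∀ f → ∑∣ R 1 f ≈ f 1 1
  ∑∣-one f = +-identityʳ (f 1 1)

  ∑∣-zero : ∀ n {f} → (∀ d e → d ℕ.* e ≡ n → f d e ≈ 0#) → ∑∣ R n f ≈ 0#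
  ∑∣-zero n {f} f≈0 = begin
    ∑∣ R n f              ≈⟨ ∑∣-cong n f≈0 ⟩
    ∑∣ R n (λ _ _ → 0#)   ≈⟨ ∑∣≈sumUpTo n (λ _ _ → 0#) ⟩
    sumUpTo n _           ≈⟨ sumUpTo-zero n (λ k _ → reflexive (if-0# (does (suc k ∣? n)))) ⟩
    0#                    ∎

  ∑∣-+ : ∀ n f g → ∑∣ R n (λ d e → f d e + g d e) ≈ ∑∣ R n f + ∑∣ R n g
  ∑∣-+ n f g = begin
    ∑∣ R n (λ d e → f d e + g d e)  ≈⟨ ∑∣≈sumUpTo n (λ d e → f d e + g d e) ⟩
    sumUpTo n _                     ≈⟨ sumUpTo-cong n (λ k _ → if-+ (does (suc k ∣? n)) _ _) ⟩
    sumUpTo n _                     ≈⟨ sumUpTo-∙ n _ _ ⟩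
    sumUpTo n _ + sumUpTo n _       ≈⟨ sym (+-cong (∑∣≈sumUpTo n f) (∑∣≈sumUpTo n g)) ⟩
    ∑∣ R n f + ∑∣ R n g             ∎

  ∑∣-neg : ∀ n f → ∑∣ R n (λ d e → - f d e) ≈ - ∑∣ R n f
  ∑∣-neg n f = begin
    ∑∣ R n (λ d e → - f d e)  ≈⟨ ∑∣≈sumUpTo n (λ d e → - f d e) ⟩
    sumUpTo n _               ≈⟨ sumUpTo-cong n (λ k _ → if-neg (does (suc k ∣? n)) _) ⟩
    sumUpTo n _               ≈⟨ sumUpTo-neg n _ ⟩
    - sumUpTo n _             ≈⟨ -‿cong (sym (∑∣≈sumUpTo n f)) ⟩
    - ∑∣ R n f                ∎

  ∑∣-sub : ∀ n f g → ∑∣ R n (λ d e → f d e - g d e) ≈ ∑∣ R n f - ∑∣ R n g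
  ∑∣-sub n f g = trans (∑∣-+ n f (λ d e → - g d e)) (+-congˡ (∑∣-neg n g))

  ∑∣-*ʳ : ∀ n f x → ∑∣ R n f * x ≈ ∑∣ R n (λ d e → f d e * x)
  ∑∣-*ʳ n f x = begin
    ∑∣ R n f * x                    ≈⟨ *-congʳ (∑∣≈sumUpTo n f) ⟩
    sumUpTo n _ * x                 ≈⟨ sumUpTo-*ʳ n x _ ⟩
    sumUpTo n _                     ≈⟨ sumUpTo-cong n (λ k _ → if-*ʳ (does (suc k ∣? n)) _ x) ⟩
    sumUpTo n _                     ≈⟨ sym (∑∣≈sumUpTo n (λ d e → f d e * x)) ⟩
    ∑∣ R n (λ d e → f d e * x)      ∎

  ∑∣-comm : ∀ m n (f : ℕ → ℕ → ℕ → Carrier) →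
            sumUpTo m (λ k → ∑∣ R n (f k)) ≈ ∑∣ R n (λ d e → sumUpTo m (λ k → f k d e))
  ∑∣-comm m n f = begin
    sumUpTo m (λ k → ∑∣ R n (f k))
      ≈⟨ sumUpTo-cong m (λ k _ → ∑∣≈sumUpTo n (f k)) ⟩
    sumUpTo m (λ k → sumUpTo n (λ j → if does (suc j ∣? n) then f k (suc j) (n / suc j) else 0#))
      ≈⟨ sumUpTo-comm m n _ ⟩
    sumUpTo n (λ j → sumUpTo m (λ k → if does (suc j ∣? n) then f k (suc j) (n / suc j) else 0#))
      ≈⟨ sumUpTo-cong n (λ j _ → sumUpTo-if m (does (suc j ∣? n)) _) ⟩
    sumUpTo n (λ j → if does (suc j ∣? n) then sumUpTo m (λ k → f k (suc j) (n / suc j)) else 0#)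
      ≈⟨ sym (∑∣≈sumUpTo n (λ d e → sumUpTo m (λ k → f k d e))) ⟩
    ∑∣ R n (λ d e → sumUpTo m (λ k → f k d e)) ∎

  ∑∣-split-one : ∀ n f → 1 ≤ n → ∑∣ R n f ≈ f 1 n + ∑∣ R n (λ d e → if does (1 ℕ.<? d) then f d e else 0#)
  ∑∣-split-one n@(suc n′) f _ = begin
    ∑∣ R n f                                         ≈⟨ ∑∣≈sumUpTo n f ⟩
    (if does (1 ∣? n) then f 1 (n / 1) else 0#) + S  ≈⟨ +-cong first (sym (+-identityˡ S)) ⟩
    f 1 n + (0# + S)                                 ≈⟨ +-congˡ (+-congʳ (reflexive (≡.sym (if-0# (does (1 ∣? n)))))) ⟩
    f 1 n + sumUpTo n G                              ≈⟨ +-congˡ (sym (∑∣≈sumUpTo n f>1)) ⟩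
    f 1 n + ∑∣ R n f>1                               ∎
    where
    S : Carrier
    S = sumUpTo n′ (λ k → if does (suc (suc k) ∣? n) then f (suc (suc k)) (n / suc (suc k)) else 0#)
    f>1 : ℕ → ℕ → Carrier
    f>1 d e = if does (1 ℕ.<? d) then f d e else 0#
    G : ℕ → Carrier
    G k = if does (suc k ∣? n) then f>1 (suc k) (n / suc k) else 0#
    first : (if does (1 ∣? n) then f 1 (n / 1) else 0#) ≈ f 1 n
    first rewrite dec-true (1 ∣? n) (1∣ n) | n/1≡n n = refl

  ∑∣-quotient-single : ∀ n g x → 1 ≤ n → g ∣ n → ∑∣ R n (λ _ e → if does (g ℕ.≟ e) then x else 0#) ≈ x
  ∑∣-quotient-single n g x 1≤n (divides zero n≡0) = contradiction n≡0 (ℕ.>⇒≢ 1≤n)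
  ∑∣-quotient-single n g x 1≤n (divides d@(suc c) n≡dg) = begin
    ∑∣ R n (λ _ e → if does (g ℕ.≟ e) then x else 0#)
      ≈⟨ ∑∣≈sumUpTo n (λ _ e → if does (g ℕ.≟ e) then x else 0#) ⟩
    sumUpTo n term
      ≈⟨ sumUpTo-single n c (∣⇒≤ {{ℕ.>-nonZero 1≤n}} d∣n) others ⟩
    term c
      ≈⟨ reflexive atD ⟩
    x ∎
    where
    term : ℕ → Carrier
    term k = if does (suc k ∣? n) then (if does (g ℕ.≟ n / suc k) then x else 0#) else 0#
    instance
      g≢0 : ℕ.NonZero g
      g≢0 = ℕ.≢-nonZero (λ { ≡.refl → ℕ.>⇒≢ 1≤n (≡.trans n≡dg (ℕ.*-zeroʳ d)) })
    d∣n : d ∣ n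
    d∣n = divides g (≡.trans n≡dg (ℕ.*-comm d g))
    n/d≡g : n / d ≡ g
    n/d≡g = ≡.trans (≡.cong (_/ d) (≡.trans n≡dg (ℕ.*-comm d g))) (m*n/n≡m g d)
    atD : term c ≡ x
    atD rewrite dec-true (d ∣? n) d∣n | n/d≡g | dec-true (g ℕ.≟ g) ≡.refl = ≡.refl
    others : ∀ k → k < n → k ≢ c → term k ≈ 0#
    others k _ k≢c = vanish (suc k ∣? n) (g ℕ.≟ n / suc k)
      where
      vanish : (k∣n? : Dec (suc k ∣ n)) (g≟n/k : Dec (g ≡ n / suc k)) →
               (if does k∣n? then (if does g≟n/k then x else 0#) else 0#) ≈ 0#
      vanish (no _)    _             = refl
      vanish (yes _)   (no _)        = refl
      vanish (yes k∣n) (yes g≡n/k) = contradiction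
        (suc-injective (ℕ.*-cancelʳ-≡ (suc k) d g
          (≡.trans (≡.trans (≡.cong (suc k ℕ.*_) g≡n/k) (m*[n/m]≡n k∣n)) n≡dg)))
        k≢c

  ∑∣-multiples : ∀ m p (f : ℕ → Carrier) →
    ∑∣ R (m ℕ.* suc p) (λ d _ → if does (suc p ∣? d) then f d else 0#)
      ≈ ∑∣ R m (λ d _ → f (d ℕ.* suc p))
  ∑∣-multiples m p f = begin
    ∑∣ R n (λ d _ → if does (P ∣? d) then f d else 0#)
      ≈⟨ ∑∣≈sumUpTo n (λ d _ → if does (P ∣? d) then f d else 0#) ⟩
    sumUpTo n (λ k → if does (suc k ∣? n) then (if does (P ∣? suc k) then f (suc k) else 0#) else 0#)
      ≈⟨ sumUpTo-cong n (λ k _ → reflexive (if-if (does (suc k ∣? n)) (does (P ∣? suc k)) (f (suc k)))) ⟩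
    sumUpTo n (λ k → if does (P ∣? suc k) then (if does (suc k ∣? n) then f (suc k) else 0#) else 0#)
      ≈⟨ sumUpTo-multiples p m (λ x → if does (x ∣? n) then f x else 0#) ⟩
    sumUpTo m (λ j → if does (suc j ℕ.* P ∣? n) then f (suc j ℕ.* P) else 0#)
      ≈⟨ sumUpTo-cong m (λ j _ → reflexive (≡.cong (λ b → if b then f (suc j ℕ.* P) else 0#)
           (does-⇔ (mk⇔ (*-cancelʳ-∣ P) (*-monoˡ-∣ P)) (suc j ℕ.* P ∣? n) (suc j ∣? m)))) ⟩
    sumUpTo m (λ j → if does (suc j ∣? m) then f (suc j ℕ.* P) else 0#)
      ≈⟨ sym (∑∣≈sumUpTo m (λ d _ → f (d ℕ.* P))) ⟩
    ∑∣ R m (λ d _ → f (d ℕ.* P)) ∎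
    where
    P : ℕ
    P = suc p
    n : ℕ
    n = m ℕ.* P

  ∑∣-transfer : ∀ {m n} (f g : ℕ → Carrier) → 1 ≤ m → m ≤ n →
    (∀ d → (if does (d ∣? n) then f d else 0#) ≈ (if does (d ∣? m) then g d else 0#)) →
    ∑∣ R n (λ d _ → f d) ≈ ∑∣ R m (λ d _ → g d)
  ∑∣-transfer {m} {n} f g 1≤m m≤n f≈g = begin
    ∑∣ R n (λ d _ → f d)
      ≈⟨ ∑∣≈sumUpTo n (λ d _ → f d) ⟩
    sumUpTo n (λ k → if does (suc k ∣? n) then f (suc k) else 0#)
      ≈⟨ sumUpTo-cong n (λ k _ → f≈g (suc k)) ⟩
    sumUpTo n G
      ≈⟨ sumUpTo-extend m n m≤n beyond ⟩
    sumUpTo m G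
      ≈⟨ sym (∑∣≈sumUpTo m (λ d _ → g d)) ⟩
    ∑∣ R m (λ d _ → g d) ∎
    where
    G : ℕ → Carrier
    G k = if does (suc k ∣? m) then g (suc k) else 0#
    beyond : ∀ k → m ≤ k → k < n → G k ≈ 0#
    beyond k m≤k _ rewrite dec-false (suc k ∣? m) (>⇒∤ {{ℕ.>-nonZero 1≤m}} (s≤s m≤k)) = refl

module MobiusSums {c ℓ : Level} (R : CommutativeRing c ℓ) where
  open CommutativeRing R
  open RingSums R
  open MobiusFunction
  open import Algebra.Properties.Ring ring using (-0#≈0#; -‿involutive)
  open ≈-Reasoning setoid

  μᴿ : ℕ → Carrier
  μᴿ n = fromℤ R (μ n)

  fromℤ-neg : ∀ z → fromℤ R (ℤ.- z) ≈ - fromℤ R z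
  fromℤ-neg (+ zero)  = sym -0#≈0#
  fromℤ-neg (+ suc n) = refl
  fromℤ-neg -[1+ n ]  = sym (-‿involutive _)

  fromℤ-μ-*-prime : ∀ {p} d → Prime p → 1 ≤ d →
                    μᴿ (d ℕ.* p) ≈ - (if does (p ∣? d) then 0# else μᴿ d)
  fromℤ-μ-*-prime {p} d pp 1≤d with p ∣? d
  ... | yes p∣d = trans (reflexive (≡.cong (fromℤ R) (μ-square pp (*-monoˡ-∣ p p∣d) 1≤dp))) (sym -0#≈0#)
    where
    1≤dp : 1 ≤ d ℕ.* p
    1≤dp = ℕ.*-mono-≤ 1≤d (ℕ.>-nonZero⁻¹ p {{prime⇒nonZero pp}})
  ... | no  p∤d = trans (reflexive (≡.cong (fromℤ R) (μ-*-prime pp p∤d 1≤d))) (fromℤ-neg (μ d))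

  -- Split the divisors of m p by whether p divides them: μ (d p) is 0 when p ∣ d and − μ d
  -- otherwise, so the two parts cancel.
  ∑∣-μ-*-prime : ∀ m p → Prime (suc p) → 1 ≤ m → ∑∣ R (m ℕ.* suc p) (λ d _ → μᴿ d) ≈ 0#
  ∑∣-μ-*-prime m p pp 1≤m = begin
    ∑∣ R n (λ d _ → μᴿ d)
      ≈⟨ ∑∣-cong n (λ d _ _ → if-split (does (P ∣? d)) (μᴿ d)) ⟩
    ∑∣ R n (λ d _ → (if does (P ∣? d) then μᴿ d else 0#) + g d)
      ≈⟨ ∑∣-+ n (λ d _ → if does (P ∣? d) then μᴿ d else 0#) (λ d _ → g d) ⟩
    ∑∣ R n (λ d _ → if does (P ∣? d) then μᴿ d else 0#) + ∑∣ R n (λ d _ → g d)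
      ≈⟨ +-cong (∑∣-multiples m p (λ d → μᴿ d)) (∑∣-transfer g g 1≤m m≤n coprimePart) ⟩
    ∑∣ R m (λ d _ → μᴿ (d ℕ.* P)) + ∑∣ R m (λ d _ → g d)
      ≈⟨ +-congʳ (∑∣-cong m (λ d e de≡m → fromℤ-μ-*-prime d pp (m*k≡n⇒1≤m 1≤m de≡m))) ⟩
    ∑∣ R m (λ d _ → - g d) + ∑∣ R m (λ d _ → g d)
      ≈⟨ +-congʳ (∑∣-neg m (λ d _ → g d)) ⟩
    - ∑∣ R m (λ d _ → g d) + ∑∣ R m (λ d _ → g d)
      ≈⟨ -‿inverseˡ _ ⟩
    0# ∎
    where
    P : ℕ
    P = suc p
    n : ℕ
    n = m ℕ.* P
    g : ℕ → Carrier
    g d = if does (P ∣? d) then 0# else μᴿ d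
    m≤n : m ≤ n
    m≤n = ℕ.m≤m*n m P
    coprimePart : ∀ d → (if does (d ∣? n) then g d else 0#) ≈ (if does (d ∣? m) then g d else 0#)
    coprimePart d = splitOn (P ∣? d)
      where
      splitOn : (P∣d? : Dec (P ∣ d)) →
        (if does (d ∣? n) then (if does P∣d? then 0# else μᴿ d) else 0#)
          ≈ (if does (d ∣? m) then (if does P∣d? then 0# else μᴿ d) else 0#)
      splitOn (yes _)  = reflexive (≡.trans (if-0# (does (d ∣? n))) (≡.sym (if-0# (does (d ∣? m)))))
      splitOn (no P∤d) = reflexive (≡.cong (λ b → if b then μᴿ d else 0#)
        (does-⇔ (mk⇔ (coprime-divisor (Coprime.sym (prime∤⇒coprime pp P∤d)) ∘ ≡.subst (d ∣_) (ℕ.*-comm m P))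
                     (∣m⇒∣m*n P))
                 (d ∣? n) (d ∣? m)))

  ∑∣-μ : ∀ n → 1 ≤ n → ∑∣ R n (λ d _ → μᴿ d) ≈ (if does (n ℕ.≟ 1) then 1# else 0#)
  ∑∣-μ 1 _ = trans (∑∣-one (λ d _ → μᴿ d)) (+-identityʳ 1#)
  ∑∣-μ n@(suc (suc _)) 1≤n with prime-divisor n (s≤s (s≤s z≤n))
  ... | zero  , pp , _             = ⊥-elim (ℕ.NonZero.nonZero (prime⇒nonZero pp))
  ... | suc p , pp , divides m n≡mp =
    trans (reflexive (≡.cong (λ k → ∑∣ R k (λ d _ → μᴿ d)) n≡mp))
          (∑∣-μ-*-prime m p pp (m*k≡n⇒1≤m 1≤n (≡.sym n≡mp)))

  ∑∣-μ-coprime : ∀ n x → 1 ≤ n →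
    ∑∣ R n (λ d _ → if does (d ∣? x) then μᴿ d else 0#) ≈ (if does (gcd x n ℕ.≟ 1) then 1# else 0#)
  ∑∣-μ-coprime n x 1≤n = trans
    (∑∣-transfer (λ d → if does (d ∣? x) then μᴿ d else 0#) (λ d → μᴿ d)
                 1≤G (gcd[m,n]≤n x n {{ℕ.>-nonZero 1≤n}}) (λ d → common d (d ∣? n) (d ∣? x) (d ∣? G)))
    (∑∣-μ G 1≤G)
    where
    G : ℕ
    G = gcd x n
    1≤G : 1 ≤ G
    1≤G = ℕ.n≢0⇒n>0 (gcd[m,n]≢0 x n (inj₂ (ℕ.>⇒≢ 1≤n)))
    common : ∀ d (d∣n? : Dec (d ∣ n)) (d∣x? : Dec (d ∣ x)) (d∣G? : Dec (d ∣ G)) →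
      (if does d∣n? then (if does d∣x? then μᴿ d else 0#) else 0#)
        ≈ (if does d∣G? then μᴿ d else 0#)
    common d (yes _)   (yes _)   (yes _)   = refl
    common d (yes d∣n) (yes d∣x) (no d∤G)  = contradiction (gcd-greatest d∣x d∣n) d∤G
    common d (yes _)   (no d∤x)  (yes d∣G) = contradiction (∣-trans d∣G (gcd[m,n]∣m x n)) d∤x
    common d (yes _)   (no _)    (no _)    = refl
    common d (no d∤n)  _         (yes d∣G) = contradiction (∣-trans d∣G (gcd[m,n]∣n x n)) d∤n
    common d (no _)    _         (no _)    = refl

module GcdClasses {c ℓ : Level} (R : CommutativeRing c ℓ) where
  open CommutativeRing R
  open RingSums R
  open ≈-Reasoning setoid

  sumUpTo-gcd≡quotient : ∀ {n} d e (F : ℕ → Carrier) → 1 ≤ n → d ℕ.* e ≡ n →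
    sumUpTo n (λ k → if does (gcd (suc k) n ℕ.≟ e) then F (suc k) else 0#)
      ≈ sumUpTo d (λ j → if does (gcd (suc j) d ℕ.≟ 1) then F (suc j ℕ.* e) else 0#)
  sumUpTo-gcd≡quotient d zero F 1≤n d*0≡n =
    contradiction (≡.trans (≡.sym d*0≡n) (ℕ.*-zeroʳ d)) (ℕ.>⇒≢ 1≤n)
  sumUpTo-gcd≡quotient {n} d e@(suc e′) F _ ≡.refl = begin
    sumUpTo n (λ k → if does (gcd (suc k) n ℕ.≟ e) then F (suc k) else 0#)
      ≈⟨ sumUpTo-cong n (λ k _ → guard k (gcd (suc k) n ℕ.≟ e) (e ∣? suc k)) ⟩
    sumUpTo n (λ k → if does (e ∣? suc k)
                       then (if does (gcd (suc k) n ℕ.≟ e) then F (suc k) else 0#) else 0#)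
      ≈⟨ sumUpTo-multiples e′ d (λ x → if does (gcd x n ℕ.≟ e) then F x else 0#) ⟩
    sumUpTo d (λ j → if does (gcd (suc j ℕ.* e) n ℕ.≟ e) then F (suc j ℕ.* e) else 0#)
      ≈⟨ sumUpTo-cong d (λ j _ → reflexive (≡.cong (λ b → if b then F (suc j ℕ.* e) else 0#)
                                   (does-⇔ (coprime⇔ j) (gcd (suc j ℕ.* e) n ℕ.≟ e) (gcd (suc j) d ℕ.≟ 1)))) ⟩
    sumUpTo d (λ j → if does (gcd (suc j) d ℕ.≟ 1) then F (suc j ℕ.* e) else 0#) ∎
    where
    guard : ∀ k (g≡e? : Dec (gcd (suc k) n ≡ e)) (e∣k? : Dec (e ∣ suc k)) →
      (if does g≡e? then F (suc k) else 0#)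
        ≈ (if does e∣k? then (if does g≡e? then F (suc k) else 0#) else 0#)
    guard k (yes g≡e) (no e∤k) = contradiction (≡.subst (_∣ suc k) g≡e (gcd[m,n]∣m (suc k) n)) e∤k
    guard k (yes _)   (yes _)  = refl
    guard k (no _)    (yes _)  = refl
    guard k (no _)    (no _)   = refl
    coprime⇔ : ∀ j → gcd (suc j ℕ.* e) n ≡ e ⇔ gcd (suc j) d ≡ 1
    coprime⇔ j = mk⇔ (gcd[m*k,n*k]≡k⇒coprime {suc j} {d} {e}) (coprime⇒gcd[m*k,n*k]≡k {suc j} {d} {e})

  sumUpTo-by-gcd : ∀ n (F : ℕ → Carrier) → 1 ≤ n →
    sumUpTo n (λ k → F (suc k))
      ≈ ∑∣ R n (λ d e → sumUpTo d (λ j → if does (gcd (suc j) d ℕ.≟ 1) then F (suc j ℕ.* e) else 0#))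
  sumUpTo-by-gcd n F 1≤n = begin
    sumUpTo n (λ k → F (suc k))
      ≈⟨ sumUpTo-cong n (λ k _ →
           sym (∑∣-quotient-single n (gcd (suc k) n) (F (suc k)) 1≤n (gcd[m,n]∣n (suc k) n))) ⟩
    sumUpTo n (λ k → ∑∣ R n (λ _ e → if does (gcd (suc k) n ℕ.≟ e) then F (suc k) else 0#))
      ≈⟨ ∑∣-comm n n (λ k _ e → if does (gcd (suc k) n ℕ.≟ e) then F (suc k) else 0#) ⟩
    ∑∣ R n (λ _ e → sumUpTo n (λ k → if does (gcd (suc k) n ℕ.≟ e) then F (suc k) else 0#))
      ≈⟨ ∑∣-cong n (λ d e de≡n → sumUpTo-gcd≡quotient d e F 1≤n de≡n) ⟩
    ∑∣ R n (λ d e → sumUpTo d (λ j → if does (gcd (suc j) d ℕ.≟ 1) then F (suc j ℕ.* e) else 0#)) ∎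

module CoprimeResidues {c ℓ : Level} (R : CommutativeRing c ℓ) where
  open CommutativeRing R
  open RawSemiringDefs (Semiring.rawSemiring semiring) using (_^_)
  open import Algebra.Properties.Semiring.Exp semiring using (^-assocʳ; ^-homo-*; ^-congʳ)
  open RingSums R
  open MobiusSums R
  open ≈-Reasoning setoid

  sumUpTo-multiples-pow : ∀ c m x →
    sumUpTo (m ℕ.* suc c) (λ k → if does (suc c ∣? suc k) then x ^ suc k else 0#)
      ≈ x ^ suc c * sumUpTo m ((x ^ suc c) ^_)
  sumUpTo-multiples-pow c m x = begin
    sumUpTo (m ℕ.* D) (λ k → if does (D ∣? suc k) then x ^ suc k else 0#)  ≈⟨ sumUpTo-multiples c m (x ^_) ⟩
    sumUpTo m (λ j → x ^ (suc j ℕ.* D))                                   ≈⟨ sumUpTo-cong m (λ j _ → pow j) ⟩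
    sumUpTo m (λ j → x ^ D * (x ^ D) ^ j)                                 ≈⟨ sym (sumUpTo-*ˡ m (x ^ D) _) ⟩
    x ^ D * sumUpTo m ((x ^ D) ^_)                                        ∎
    where
    D : ℕ
    D = suc c
    pow : ∀ j → x ^ (suc j ℕ.* D) ≈ x ^ D * (x ^ D) ^ j
    pow j = trans (^-homo-* x D (j ℕ.* D))
                  (*-congˡ (trans (^-congʳ x (ℕ.*-comm j D)) (sym (^-assocʳ x D j))))

  Ψ-inverse : ∀ d x (w : ℕ → Carrier) W → 1 ≤ d →
    (∀ d′ → d′ ∣ d → (1# - x ^ d′) * w d′ ≈ 1#) → (1# - x ^ d) * W ≈ 1# →
    Ψ R d x * W ≈ ∑∣ R d (λ d′ _ → μᴿ d′ * (x ^ d′ * w d′))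
  Ψ-inverse d x w W 1≤d w-inverse W-inverse = begin
    Ψ R d x * W
      ≈⟨ *-congʳ (reflexive (∑<≡sumUpTo d _)) ⟩
    sumUpTo d (λ j → if does (gcd (suc j) d ℕ.≟ 1) then x ^ suc j else 0#) * W
      ≈⟨ *-congʳ (sumUpTo-cong d (λ j _ → coprimality j)) ⟩
    sumUpTo d (λ j → ∑∣ R d (λ d′ _ → term d′ j)) * W
      ≈⟨ *-congʳ (∑∣-comm d d (λ j d′ _ → term d′ j)) ⟩
    ∑∣ R d (λ d′ _ → sumUpTo d (term d′)) * W
      ≈⟨ ∑∣-*ʳ d (λ d′ _ → sumUpTo d (term d′)) W ⟩
    ∑∣ R d (λ d′ _ → sumUpTo d (term d′) * W)
      ≈⟨ ∑∣-cong d (λ d′ m d′m≡d → divisorTerm d′ m d′m≡d) ⟩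
    ∑∣ R d (λ d′ _ → μᴿ d′ * (x ^ d′ * w d′)) ∎
    where
    term : ℕ → ℕ → Carrier
    term d′ j = if does (d′ ∣? suc j) then μᴿ d′ * x ^ suc j else 0#
    coprimality : ∀ j → (if does (gcd (suc j) d ℕ.≟ 1) then x ^ suc j else 0#) ≈ ∑∣ R d (λ d′ _ → term d′ j)
    coprimality j = begin
      (if does (gcd (suc j) d ℕ.≟ 1) then x ^ suc j else 0#)
        ≈⟨ if≈if1#* (does (gcd (suc j) d ℕ.≟ 1)) (x ^ suc j) ⟩
      (if does (gcd (suc j) d ℕ.≟ 1) then 1# else 0#) * x ^ suc j
        ≈⟨ *-congʳ (sym (∑∣-μ-coprime d (suc j) 1≤d)) ⟩
      ∑∣ R d (λ d′ _ → if does (d′ ∣? suc j) then μᴿ d′ else 0#) * x ^ suc j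
        ≈⟨ ∑∣-*ʳ d (λ d′ _ → if does (d′ ∣? suc j) then μᴿ d′ else 0#) (x ^ suc j) ⟩
      ∑∣ R d (λ d′ _ → (if does (d′ ∣? suc j) then μᴿ d′ else 0#) * x ^ suc j)
        ≈⟨ ∑∣-cong d (λ d′ _ _ → if-*ʳ (does (d′ ∣? suc j)) (μᴿ d′) (x ^ suc j)) ⟩
      ∑∣ R d (λ d′ _ → term d′ j) ∎
    divisorTerm : ∀ d′ m → d′ ℕ.* m ≡ d → sumUpTo d (term d′) * W ≈ μᴿ d′ * (x ^ d′ * w d′)
    divisorTerm zero    m 0≡d  = contradiction (≡.sym 0≡d) (ℕ.>⇒≢ 1≤d)
    divisorTerm d′@(suc c) m d′m≡d = begin
      sumUpTo d (term d′) * W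
        ≈⟨ *-congʳ (sumUpTo-cong d (λ j _ → sym (if-*ˡ (does (d′ ∣? suc j)) μd′ (x ^ suc j)))) ⟩
      sumUpTo d (λ j → μd′ * multiple j) * W
        ≈⟨ *-congʳ (sym (sumUpTo-*ˡ d μd′ multiple)) ⟩
      μd′ * sumUpTo d multiple * W
        ≈⟨ *-assoc μd′ _ W ⟩
      μd′ * (sumUpTo d multiple * W)
        ≡⟨ ≡.cong (λ n → μd′ * (sumUpTo n multiple * W)) d≡md′ ⟩
      μd′ * (sumUpTo (m ℕ.* d′) multiple * W)
        ≈⟨ *-congˡ (*-congʳ (sumUpTo-multiples-pow c m x)) ⟩
      μd′ * (x ^ d′ * sumUpTo m ((x ^ d′) ^_) * W)
        ≈⟨ *-congˡ (*-assoc (x ^ d′) _ W) ⟩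
      μd′ * (x ^ d′ * (sumUpTo m ((x ^ d′) ^_) * W))
        ≈⟨ *-congˡ (*-congˡ (geometric-sum-inverse m (x ^ d′) (w d′) W
                               (w-inverse d′ (divides m d≡md′)) W-inverse′)) ⟩
      μd′ * (x ^ d′ * w d′) ∎
      where
      μd′ : Carrier
      μd′ = μᴿ d′
      multiple : ℕ → Carrier
      multiple j = if does (d′ ∣? suc j) then x ^ suc j else 0#
      d≡md′ : d ≡ m ℕ.* d′
      d≡md′ = ≡.trans (≡.sym d′m≡d) (ℕ.*-comm d′ m)
      W-inverse′ : (1# - (x ^ d′) ^ m) * W ≈ 1#
      W-inverse′ = trans (*-congʳ (+-congˡ (-‿cong (trans (^-assocʳ x d′ m) (^-congʳ x d′m≡d))))) W-inverse

module GcdPeriodicSeries {c ℓ : Level} (R : CommutativeRing c ℓ) where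
  open CommutativeRing R
  open RawSemiringDefs (Semiring.rawSemiring semiring) using (_^_)
  open import Algebra.Properties.Semiring.Exp semiring using (^-assocʳ; ^-congʳ)
  open import Algebra.Properties.Ring ring using (x[y-z]≈xy-xz)
  open RingSums R
  open MobiusSums R
  open GcdClasses R
  open CoprimeResidues R
  open ≈-Reasoning setoid

  module Series (h : ℕ) (h≥1 : h ≥ 1) (a : ℤ → Carrier) (a-gcd : ∀ k → a k ≈ a (+ gcd ∣ k ∣ h))
                (q : Carrier) where

    a₀ : Carrier
    a₀ = a (+ 0)

    a[h]≈a₀ : a (+ h) ≈ a₀
    a[h]≈a₀ = sym (trans (a-gcd (+ 0)) (reflexive (≡.cong (λ n → a (+ n)) gcd[0,h]≡h)))
      where
      gcd[0,h]≡h : gcd 0 h ≡ h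
      gcd[0,h]≡h = ∣-antisym (gcd[m,n]∣n 0 h) (gcd-greatest (h ∣0) ∣-refl)

    a-coprime-multiple : ∀ {d e j} → d ℕ.* e ≡ h → gcd j d ≡ 1 → a (+ (j ℕ.* e)) ≈ a (+ e)
    a-coprime-multiple {d} {e} {j} de≡h coprime =
      trans (a-gcd (+ (j ℕ.* e))) (reflexive (≡.cong (λ n → a (+ n)) gcd[je,h]≡e))
      where
      gcd[je,h]≡e : gcd (j ℕ.* e) h ≡ e
      gcd[je,h]≡e = ≡.subst (λ n → gcd (j ℕ.* e) n ≡ e) de≡h (coprime⇒gcd[m*k,n*k]≡k {j} {d} {e} coprime)

    A T : Carrier
    A = ∑< R h (λ k → a (+ k) * q ^ k)
    T = ∑∣ R h (λ d e → a (+ e) * Ψ R d (q ^ e))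

    sum-by-gcd : sumUpTo h (λ k → a (+ suc k) * q ^ suc k) ≈ T
    sum-by-gcd = trans (sumUpTo-by-gcd h (λ k → a (+ k) * q ^ k) h≥1) (∑∣-cong h gcdClass)
      where
      gcdClass : ∀ d e → d ℕ.* e ≡ h →
        sumUpTo d (λ j → if does (gcd (suc j) d ℕ.≟ 1) then a (+ (suc j ℕ.* e)) * q ^ (suc j ℕ.* e) else 0#)
          ≈ a (+ e) * Ψ R d (q ^ e)
      gcdClass d e de≡h = begin
        sumUpTo d (λ j → if does (coprime? j) then a (+ (suc j ℕ.* e)) * q ^ (suc j ℕ.* e) else 0#)
          ≈⟨ sumUpTo-cong d (λ j _ → coprimeTerm j (coprime? j)) ⟩
        sumUpTo d (λ j → a (+ e) * (if does (coprime? j) then (q ^ e) ^ suc j else 0#))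
          ≈⟨ sym (sumUpTo-*ˡ d (a (+ e)) _) ⟩
        a (+ e) * sumUpTo d (λ j → if does (coprime? j) then (q ^ e) ^ suc j else 0#)
          ≈⟨ *-congˡ (reflexive (≡.sym (∑<≡sumUpTo d _))) ⟩
        a (+ e) * Ψ R d (q ^ e) ∎
        where
        coprime? : ∀ j → Dec (gcd (suc j) d ≡ 1)
        coprime? j = gcd (suc j) d ℕ.≟ 1
        coprimeTerm : ∀ j (coprime?ʲ : Dec (gcd (suc j) d ≡ 1)) →
          (if does coprime?ʲ then a (+ (suc j ℕ.* e)) * q ^ (suc j ℕ.* e) else 0#)
            ≈ a (+ e) * (if does coprime?ʲ then (q ^ e) ^ suc j else 0#)
        coprimeTerm j (yes coprime) = *-cong (a-coprime-multiple {d} {e} {suc j} de≡h coprime)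
          (trans (^-congʳ q (ℕ.*-comm (suc j) e)) (sym (^-assocʳ q e (suc j))))
        coprimeTerm j (no _) = sym (zeroʳ _)

    A+a₀qʰ≈a₀+T : A + a₀ * q ^ h ≈ a₀ + T
    A+a₀qʰ≈a₀+T = begin
      A + a₀ * q ^ h                     ≈⟨ +-cong (reflexive (∑<≡sumUpTo h G)) (*-congʳ (sym a[h]≈a₀)) ⟩
      sumUpTo h G + G h                  ≈⟨ sym (sumUpTo-suc h G) ⟩
      G 0 + sumUpTo h (λ k → G (suc k))  ≈⟨ +-cong (*-identityʳ a₀) sum-by-gcd ⟩
      a₀ + T                             ∎
      where
      G : ℕ → Carrier
      G k = a (+ k) * q ^ k

    module Inverses (inv : ℕ → Carrier) (inv-spec : ∀ e → e ∣ h → (1# - q ^ e) * inv e ≈ 1#) where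

      Z W V : Carrier
      Z = ∑∣ R h (λ d e → a (+ e) * ∑∣ R d (λ d′ _ → μᴿ d′ * (q ^ (e ℕ.* d′) * inv (e ℕ.* d′))))
      W = ∑∣ R h (λ d e → a (+ e) * ∑∣ R d (λ d′ _ → μᴿ d′ * inv (e ℕ.* d′)))
      V = ∑∣ R h (λ d e → if does (1 ℕ.<? d)
                            then a (+ e) * ∑∣ R d (λ d′ _ → μᴿ d′ * inv (e ℕ.* d′))
                            else 0#)

      e*d′∣h : ∀ {d e d′} → d ℕ.* e ≡ h → d′ ∣ d → e ℕ.* d′ ∣ h
      e*d′∣h {d} {e} de≡h d′∣d = ≡.subst (e ℕ.* _ ∣_) (≡.trans (ℕ.*-comm e d) de≡h) (*-monoʳ-∣ e d′∣d)

      qᵉinv≈inv-1 : ∀ e → e ∣ h → q ^ e * inv e ≈ inv e - 1#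
      qᵉinv≈inv-1 e e∣h = [1-y]z≈1⇒yz≈z-1 (q ^ e) (inv e) (inv-spec e e∣h)

      a₀qʰinv≈a₀inv-a₀ : a₀ * (q ^ h * inv h) ≈ a₀ * inv h - a₀
      a₀qʰinv≈a₀inv-a₀ = yz≈z-1⇒x[yz]≈xz-x a₀ (qᵉinv≈inv-1 h ∣-refl)

      A*inv-a₀≈T*inv : A * inv h - a₀ ≈ T * inv h
      A*inv-a₀≈T*inv = x+[b-a]≈b+t⇒x-a≈t (A * inv h) a₀ (a₀ * inv h) (T * inv h) (begin
        A * inv h + (a₀ * inv h - a₀)     ≈⟨ +-congˡ (sym a₀qʰinv≈a₀inv-a₀) ⟩
        A * inv h + a₀ * (q ^ h * inv h)  ≈⟨ +-congˡ (sym (*-assoc a₀ (q ^ h) (inv h))) ⟩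
        A * inv h + a₀ * q ^ h * inv h    ≈⟨ sym (distribʳ (inv h) A (a₀ * q ^ h)) ⟩
        (A + a₀ * q ^ h) * inv h          ≈⟨ *-congʳ A+a₀qʰ≈a₀+T ⟩
        (a₀ + T) * inv h                  ≈⟨ distribʳ (inv h) a₀ T ⟩
        a₀ * inv h + T * inv h            ∎)

      Ψ*inv : ∀ d e → d ℕ.* e ≡ h →
        Ψ R d (q ^ e) * inv h ≈ ∑∣ R d (λ d′ _ → μᴿ d′ * (q ^ (e ℕ.* d′) * inv (e ℕ.* d′)))
      Ψ*inv d e de≡h = trans
        (Ψ-inverse d (q ^ e) (λ d′ → inv (e ℕ.* d′)) (inv h) (m*k≡n⇒1≤m h≥1 de≡h) w-inverse W-inverse)
        (∑∣-cong d (λ d′ _ _ → *-congˡ {μᴿ d′} (*-congʳ {inv (e ℕ.* d′)} (^-assocʳ q e d′))))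
        where
        [qᵉ]ᵏ≈qᵉᵏ : ∀ k → 1# - (q ^ e) ^ k ≈ 1# - q ^ (e ℕ.* k)
        [qᵉ]ᵏ≈qᵉᵏ k = +-congˡ (-‿cong (^-assocʳ q e k))
        w-inverse : ∀ d′ → d′ ∣ d → (1# - (q ^ e) ^ d′) * inv (e ℕ.* d′) ≈ 1#
        w-inverse d′ d′∣d = trans (*-congʳ ([qᵉ]ᵏ≈qᵉᵏ d′)) (inv-spec _ (e*d′∣h de≡h d′∣d))
        W-inverse : (1# - (q ^ e) ^ d) * inv h ≈ 1#
        W-inverse = trans (*-congʳ ([qᵉ]ᵏ≈qᵉᵏ d))
                          (≡.subst (λ n → (1# - q ^ n) * inv h ≈ 1#) (≡.sym (≡.trans (ℕ.*-comm e d) de≡h))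
                                   (inv-spec h ∣-refl))

      T*inv≈Z : T * inv h ≈ Z
      T*inv≈Z = trans (∑∣-*ʳ h (λ d e → a (+ e) * Ψ R d (q ^ e)) (inv h))
                      (∑∣-cong h (λ d e de≡h → trans (*-assoc (a (+ e)) _ (inv h)) (*-congˡ (Ψ*inv d e de≡h))))

      ∑∣a∑∣μ≈a₀ : ∑∣ R h (λ d e → a (+ e) * ∑∣ R d (λ d′ _ → μᴿ d′)) ≈ a₀
      ∑∣a∑∣μ≈a₀ = begin
        ∑∣ R h (λ d e → a (+ e) * ∑∣ R d (λ d′ _ → μᴿ d′))
          ≈⟨ ∑∣-split-one h (λ d e → a (+ e) * ∑∣ R d (λ d′ _ → μᴿ d′)) h≥1 ⟩
        a (+ h) * ∑∣ R 1 (λ d′ _ → μᴿ d′)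
          + ∑∣ R h (λ d e → if does (1 ℕ.<? d) then a (+ e) * ∑∣ R d (λ d′ _ → μᴿ d′) else 0#)
          ≈⟨ +-cong (*-cong a[h]≈a₀ (∑∣-μ 1 (s≤s z≤n))) (∑∣-zero h (λ d e _ → nontrivial d e (1 ℕ.<? d))) ⟩
        a₀ * 1# + 0#  ≈⟨ trans (+-identityʳ _) (*-identityʳ a₀) ⟩
        a₀            ∎
        where
        nontrivial : ∀ d e (1<d? : Dec (1 < d)) →
          (if does 1<d? then a (+ e) * ∑∣ R d (λ d′ _ → μᴿ d′) else 0#) ≈ 0#
        nontrivial d e (no _)    = refl
        nontrivial d e (yes 1<d) = begin
          a (+ e) * ∑∣ R d (λ d′ _ → μᴿ d′)
            ≈⟨ *-congˡ (∑∣-μ d (ℕ.<⇒≤ 1<d)) ⟩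
          a (+ e) * (if does (d ℕ.≟ 1) then 1# else 0#)
            ≡⟨ ≡.cong (λ b → a (+ e) * (if b then 1# else 0#)) (dec-false (d ℕ.≟ 1) (ℕ.>⇒≢ 1<d)) ⟩
          a (+ e) * 0#
            ≈⟨ zeroʳ (a (+ e)) ⟩
          0# ∎

      Z≈W-a₀ : Z ≈ W - a₀
      Z≈W-a₀ = begin
        ∑∣ R h (λ d e → a (+ e) * ∑∣ R d (λ d′ _ → μᴿ d′ * (q ^ (e ℕ.* d′) * inv (e ℕ.* d′))))
          ≈⟨ ∑∣-cong h (λ d e de≡h → *-congˡ {a (+ e)} (∑∣-cong d (λ d′ m d′m≡d →
               divisorTerm de≡h (≡.subst (d′ ∣_) d′m≡d (m∣m*n m))))) ⟩
        ∑∣ R h (λ d e → a (+ e) * ∑∣ R d (λ d′ _ → μᴿ d′ * inv (e ℕ.* d′) - μᴿ d′))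
          ≈⟨ ∑∣-cong h (λ d e _ → trans (*-congˡ (∑∣-sub d (λ d′ _ → μᴿ d′ * inv (e ℕ.* d′)) (λ d′ _ → μᴿ d′)))
                                       (x[y-z]≈xy-xz (a (+ e)) _ _)) ⟩
        ∑∣ R h (λ d e → W-term d e - a (+ e) * ∑∣ R d (λ d′ _ → μᴿ d′))
          ≈⟨ ∑∣-sub h W-term (λ d e → a (+ e) * ∑∣ R d (λ d′ _ → μᴿ d′)) ⟩
        W - ∑∣ R h (λ d e → a (+ e) * ∑∣ R d (λ d′ _ → μᴿ d′))
          ≈⟨ +-congˡ (-‿cong ∑∣a∑∣μ≈a₀) ⟩
        W - a₀ ∎
        where
        W-term : ℕ → ℕ → Carrier
        W-term d e = a (+ e) * ∑∣ R d (λ d′ _ → μᴿ d′ * inv (e ℕ.* d′))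
        divisorTerm : ∀ {d e d′} → d ℕ.* e ≡ h → d′ ∣ d →
          μᴿ d′ * (q ^ (e ℕ.* d′) * inv (e ℕ.* d′)) ≈ μᴿ d′ * inv (e ℕ.* d′) - μᴿ d′
        divisorTerm {d} {e} {d′} de≡h d′∣d =
          yz≈z-1⇒x[yz]≈xz-x (μᴿ d′) (qᵉinv≈inv-1 (e ℕ.* d′) (e*d′∣h de≡h d′∣d))

      W≈a₀inv+V : W ≈ a₀ * inv h + V
      W≈a₀inv+V = trans (∑∣-split-one h (λ d e → a (+ e) * ∑∣ R d (λ d′ _ → μᴿ d′ * inv (e ℕ.* d′))) h≥1)
                        (+-congʳ (*-cong a[h]≈a₀ d=1-term))
        where
        d=1-term : ∑∣ R 1 (λ d′ _ → μᴿ d′ * inv (h ℕ.* d′)) ≈ inv h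
        d=1-term = trans (∑∣-one (λ d′ _ → μᴿ d′ * inv (h ℕ.* d′)))
                   (trans (*-congʳ (+-identityʳ 1#)) (trans (*-identityˡ _) (reflexive (≡.cong inv (ℕ.*-identityʳ h)))))

proposition7 : {c ℓ : Level} (R : CommutativeRing c ℓ) →
  let open CommutativeRing R
      open RawSemiringDefs (Semiring.rawSemiring semiring) using (_^_)
  in (h : ℕ) → h ≥ 1 →
     (a : ℤ → Carrier) → (∀ k → a k ≈ a (+ gcd ∣ k ∣ h)) →
     (q : Carrier) → (inv : ℕ → Carrier) →
     (∀ e → e ∣ h → (1# - q ^ e) * inv e ≈ 1#) →
     let A = ∑< R h (λ k → a (+ k) * q ^ k)
     in ((A * inv h - a (+ 0))
           ≈ (∑∣ R h (λ d hd → a (+ hd) * Ψ R d (q ^ hd)) * inv h))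
      × ((∑∣ R h (λ d hd → a (+ hd) * Ψ R d (q ^ hd)) * inv h)
           ≈ ∑∣ R h (λ d hd → a (+ hd) *
                ∑∣ R d (λ d′ _ → fromℤ R (μ d′) * (q ^ (hd ℕ.* d′) * inv (hd ℕ.* d′)))))
      × (∑∣ R h (λ d hd → a (+ hd) *
                ∑∣ R d (λ d′ _ → fromℤ R (μ d′) * (q ^ (hd ℕ.* d′) * inv (hd ℕ.* d′))))
           ≈ (a (+ 0) * (q ^ h * inv h)
              + ∑∣ R h (λ d hd → if does (1 ℕ.<? d)
                   then a (+ hd) * ∑∣ R d (λ d′ _ → fromℤ R (μ d′) * inv (hd ℕ.* d′))
                   else 0#)))
      × ((A * inv h)
           ≈ ∑∣ R h (λ d hd → a (+ hd) * ∑∣ R d (λ d′ _ → fromℤ R (μ d′) * inv (hd ℕ.* d′))))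
proposition7 R h h≥1 a a-gcd q inv inv-spec = A*inv-a₀≈T*inv , T*inv≈Z , Z≈a₀qʰinv+V , A*inv≈W
  where
  open CommutativeRing R
  open RawSemiringDefs (Semiring.rawSemiring semiring) using (_^_)
  open import Algebra.Properties.Ring ring using (+-cancelʳ)
  open RingSums R using ([b+v]-a≈[b-a]+v)
  open GcdPeriodicSeries R
  open Series h h≥1 a a-gcd q
  open Inverses inv inv-spec
  open ≈-Reasoning setoid

  Z≈a₀qʰinv+V : Z ≈ a₀ * (q ^ h * inv h) + V
  Z≈a₀qʰinv+V = begin
    Z                            ≈⟨ Z≈W-a₀ ⟩
    W - a₀                       ≈⟨ +-congʳ W≈a₀inv+V ⟩
    (a₀ * inv h + V) - a₀        ≈⟨ [b+v]-a≈[b-a]+v a₀ (a₀ * inv h) V ⟩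
    (a₀ * inv h - a₀) + V        ≈⟨ +-congʳ (sym a₀qʰinv≈a₀inv-a₀) ⟩
    a₀ * (q ^ h * inv h) + V     ∎

  A*inv≈W : A * inv h ≈ W
  A*inv≈W = +-cancelʳ (- a₀) (A * inv h) W (trans A*inv-a₀≈T*inv (trans T*inv≈Z Z≈W-a₀))
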